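{- For all integers $a\ge1$ and $0\le p\le a$, $E_{a,p}[(\mathtt t\mathtt d)^a]\ge a\bigl(1-(1-1/a)^p\bigr)$.
   Context: Setting: uniform decremental sets played by UniRand (which at each step collects a uniformly random pending item if one exists). A configuration $(a,p)$ means $a$ active items of which $p$ are pending for UniRand, the pending set being a uniformly random $p$-subset of the active items. An adversary strategy is a word in $\{\mathtt t,\mathtt d\}^*$: $\mathtt t$ = the adversary collects an item and UniRand collects a uniformly random pending item if it has one; $\mathtt d$ = one active item is deleted. $E_{a,p}[S]$ is the expected number of items collected by UniRand starting from $(a,p)$ against $S$; equivalently $E_{a,p}[\varepsilon]=0$, $E_{a,p}[\mathtt t S']=1+E_{a,p-1}[S']$ if $p\ge1$, $E_{a,0}[\mathtt t S']=E_{a,0}[S']$, and $E_{a,p}[\mathtt d S']=\frac{a-p}{a}E_{a-1,p}[S']+\frac{p}{a}E_{a-1,p-1}[S']$. -}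

module Defs where

open import Data.Nat using (ℕ; zero; suc)
open import Data.Integer using (+_)
open import Data.Rational using (ℚ; _+_; _*_; _/_; 0ℚ; 1ℚ)
open import Data.List using (List; []; _∷_; replicate; concat)

-- Adversary moves: t = adversary collects (UniRand collects a random pending item),
-- d = one active item is deleted.
data Move : Set where
  t d : Move

Strategy : Set
Strategy = List Move

td^ : ℕ → Strategy
td^ n = concat (replicate n (t ∷ d ∷ []))

-- E a p S : expected number of items collected by UniRand from configuration (a,p)
-- against strategy S, defined by the recursion in the paper.
-- Convention: a deletion from a configuration with a = 0 active items is
-- meaningless; we set the value to 0 there (never reached from valid (a,p) with p ≤ a
-- against (td)^a).
E : ℕ → ℕ → Strategy → ℚ
E a p [] = 0ℚ
E a (suc p) (t ∷ S) = 1ℚ + E a p S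
E a zero (t ∷ S) = E a zero S
E zero p (d ∷ S) = 0ℚ
E (suc a) zero (d ∷ S) = E a zero S
E (suc a) (suc p) (d ∷ S) =
  ((+ (a Data.Nat.∸ p)) / suc a) * E a (suc p) S + ((+ suc p) / suc a) * E a p S

infixr 8 _^ℚ_
_^ℚ_ : ℚ → ℕ → ℚ
q ^ℚ zero = 1ℚ
q ^ℚ suc n = q * (q ^ℚ n)

-- Write E_{a,p} for E_{a,p}[(td)^a].  After the first round t·d from (a, p), with p ≥ 2 and
-- B = a − 1, the expectation obeys
--   E_{a,p} = 1 + ((B − (p − 2))/a) E_{B,p−1} + ((p − 1)/a) E_{B,p−2}
-- with nonnegative weights, so by induction on a it suffices that f(a, p) = a(1 − (1 − 1/a)^p)
-- satisfies this recursion as an inequality.  With m = p − 2, the right-hand side evaluated at f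
-- equals a − (1/a)(1 − 1/B)^m (B² + m), and since 1 − 1/B = (1 − 1/B²)·B/a the inequality
-- reduces to (1 − 1/B²)^m (1 + m/B²) ≤ 1, which is Bernoulli's inequality.

module Submission where

open import Defs
open import Data.Nat using (ℕ; suc)
open import Data.Integer using (+_)
open import Data.Rational using (ℚ; _-_; _*_; _/_; 1ℚ)

open import Level using (0ℓ)
open import Data.List using (_∷_; [])
open import Data.Sum using (inj₁; inj₂)
open import Data.Nat using (zero; s≤s)
import Data.Nat as ℕ
import Data.Nat.Properties as ℕ
import Data.Integer as ℤ
import Data.Integer.Properties as ℤ
open import Data.Rational using (0ℚ; _+_; -_; _≤_; fromℚᵘ; toℚᵘ; nonNegative; nonPositive)
open import Data.Rational.Properties
import Data.Rational.Unnormalised as ℚᵘ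
import Data.Rational.Unnormalised.Properties as ℚᵘ
open import Relation.Binary.PropositionalEquality
open import Relation.Nullary.Decidable using (dec⇒maybe)
open import Tactic.RingSolver using (solve-∀; solve)
open import Tactic.RingSolver.Core.AlmostCommutativeRing using (AlmostCommutativeRing; fromCommutativeRing)

ℚ-ring : AlmostCommutativeRing 0ℓ 0ℓ
ℚ-ring = fromCommutativeRing +-*-commutativeRing (λ x → dec⇒maybe (0ℚ ≟ x))

fromℕ : ℕ → ℚ
fromℕ n = + n / 1

fromℚᵘ-homo-+ : ∀ p q → fromℚᵘ (p ℚᵘ.+ q) ≡ fromℚᵘ p + fromℚᵘ q
fromℚᵘ-homo-+ p q = toℚᵘ-injective (ℚᵘ.≃-trans (toℚᵘ-fromℚᵘ (p ℚᵘ.+ q)) (ℚᵘ.≃-sym (ℚᵘ.≃-trans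
  (toℚᵘ-homo-+ (fromℚᵘ p) (fromℚᵘ q)) (ℚᵘ.+-cong (toℚᵘ-fromℚᵘ p) (toℚᵘ-fromℚᵘ q)))))

fromℚᵘ-homo-* : ∀ p q → fromℚᵘ (p ℚᵘ.* q) ≡ fromℚᵘ p * fromℚᵘ q
fromℚᵘ-homo-* p q = toℚᵘ-injective (ℚᵘ.≃-trans (toℚᵘ-fromℚᵘ (p ℚᵘ.* q)) (ℚᵘ.≃-sym (ℚᵘ.≃-trans
  (toℚᵘ-homo-* (fromℚᵘ p) (fromℚᵘ q)) (ℚᵘ.*-cong (toℚᵘ-fromℚᵘ p) (toℚᵘ-fromℚᵘ q)))))

fromℕ-homo-+ : ∀ m n → fromℕ (m ℕ.+ n) ≡ fromℕ m + fromℕ n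
fromℕ-homo-+ m n = trans (fromℚᵘ-cong {ℚᵘ.mkℚᵘ (+ (m ℕ.+ n)) 0} {ℚᵘ.mkℚᵘ (+ m) 0 ℚᵘ.+ ℚᵘ.mkℚᵘ (+ n) 0} (ℚᵘ.*≡* eq))
  (fromℚᵘ-homo-+ (ℚᵘ.mkℚᵘ (+ m) 0) (ℚᵘ.mkℚᵘ (+ n) 0))
  where
  eq : + (m ℕ.+ n) ℤ.* + 1 ≡ (+ m ℤ.* + 1 ℤ.+ + n ℤ.* + 1) ℤ.* + 1
  eq rewrite ℤ.*-identityʳ (+ m) | ℤ.*-identityʳ (+ n) = cong (ℤ._* + 1) (ℤ.pos-+ m n)

+k/n≡k*[1/n] : ∀ k n → + k / suc n ≡ fromℕ k * (+ 1 / suc n)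
+k/n≡k*[1/n] k n = trans (fromℚᵘ-cong {ℚᵘ.mkℚᵘ (+ k) n} {ℚᵘ.mkℚᵘ (+ k) 0 ℚᵘ.* ℚᵘ.mkℚᵘ (+ 1) n} (ℚᵘ.*≡* eq))
  (fromℚᵘ-homo-* (ℚᵘ.mkℚᵘ (+ k) 0) (ℚᵘ.mkℚᵘ (+ 1) n))
  where
  eq : + k ℤ.* + suc (n ℕ.+ 0) ≡ (+ k ℤ.* + 1) ℤ.* + suc n
  eq rewrite ℕ.+-identityʳ n | ℤ.*-identityʳ (+ k) = refl

n*[1/n]≡1 : ∀ n → fromℕ (suc n) * (+ 1 / suc n) ≡ 1ℚ
n*[1/n]≡1 n = trans (sym (fromℚᵘ-homo-* p (ℚᵘ.1/ p))) (fromℚᵘ-cong (ℚᵘ.*-inverseʳ p))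
  where p = ℚᵘ.mkℚᵘ (+ suc n) 0

fromℕ-nonNeg : ∀ n → 0ℚ ≤ fromℕ n
fromℕ-nonNeg n = nonNegative⁻¹ (fromℕ n) {{normalize-nonNeg n 1}}

fromℕ-homo-∸ : ∀ {m n} → n ℕ.≤ m → fromℕ (m ℕ.∸ n) ≡ fromℕ m - fromℕ n
fromℕ-homo-∸ {m} {n} n≤m = begin
  fromℕ (m ℕ.∸ n)                       ≡⟨ x≡y+x-y (fromℕ (m ℕ.∸ n)) (fromℕ n) ⟩
  fromℕ n + fromℕ (m ℕ.∸ n) - fromℕ n   ≡⟨ cong (_- fromℕ n) (fromℕ-homo-+ n (m ℕ.∸ n)) ⟨
  fromℕ (n ℕ.+ (m ℕ.∸ n)) - fromℕ n     ≡⟨ cong (λ k → fromℕ k - fromℕ n) (ℕ.m+[n∸m]≡n n≤m) ⟩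
  fromℕ m - fromℕ n                     ∎
  where
  open ≡-Reasoning
  x≡y+x-y : ∀ x y → x ≡ y + x - y
  x≡y+x-y = solve-∀ ℚ-ring

0≤* : ∀ {x y} → 0ℚ ≤ x → 0ℚ ≤ y → 0ℚ ≤ x * y
0≤* {x} {y} 0≤x 0≤y =
  nonNegative⁻¹ (x * y) {{nonNeg*nonNeg⇒nonNeg x {{nonNegative 0≤x}} y {{nonNegative 0≤y}}}}

0≤x*x : ∀ x → 0ℚ ≤ x * x
0≤x*x x with ≤-total 0ℚ x
... | inj₁ 0≤x = 0≤* 0≤x 0≤x
... | inj₂ x≤0 = nonNegative⁻¹ (x * x) {{nonPos*nonPos⇒nonPos x {{nonPositive x≤0}} x {{nonPositive x≤0}}}}

x-y≤x : ∀ {x y} → 0ℚ ≤ y → x - y ≤ x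
x-y≤x {x} 0≤y = ≤-trans (+-monoʳ-≤ x (neg-antimono-≤ 0≤y)) (≤-reflexive (+-identityʳ x))

^ℚ-nonNeg : ∀ {x} → 0ℚ ≤ x → ∀ m → 0ℚ ≤ x ^ℚ m
^ℚ-nonNeg 0≤x zero = nonNegative⁻¹ 1ℚ
^ℚ-nonNeg 0≤x (suc m) = 0≤* 0≤x (^ℚ-nonNeg 0≤x m)

^ℚ-distribʳ-* : ∀ x y m → (x * y) ^ℚ m ≡ x ^ℚ m * y ^ℚ m
^ℚ-distribʳ-* x y zero = refl
^ℚ-distribʳ-* x y (suc m) = trans (cong ((x * y) *_) (^ℚ-distribʳ-* x y m)) (swap x y (x ^ℚ m) (y ^ℚ m))
  where
  swap : ∀ a b c d → a * b * (c * d) ≡ a * c * (b * d)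
  swap = solve-∀ ℚ-ring

-- Bernoulli's inequality (1 + x)^m ≥ 1 + m x, rewritten for y = 1/(1 + x) so that no division occurs.
bernoulli : ∀ {y} → 0ℚ ≤ y → ∀ m → y ^ℚ m * (1ℚ + fromℕ m * (1ℚ - y)) ≤ 1ℚ
bernoulli {y} 0≤y zero = ≤-reflexive (1*[1+0*x]≡1 (1ℚ - y))
  where
  1*[1+0*x]≡1 : ∀ x → 1ℚ * (1ℚ + 0ℚ * x) ≡ 1ℚ
  1*[1+0*x]≡1 = solve-∀ ℚ-ring
bernoulli {y} 0≤y (suc m) = begin
  y * Y * (1ℚ + fromℕ (suc m) * (1ℚ - y))
    ≡⟨ cong (λ k → y * Y * (1ℚ + k * (1ℚ - y))) (fromℕ-homo-+ 1 m) ⟩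
  y * Y * (1ℚ + (1ℚ + M) * (1ℚ - y))
    ≡⟨ expand y Y M ⟩
  Y * (1ℚ + M * (1ℚ - y)) - (1ℚ + M) * (Y * ((1ℚ - y) * (1ℚ - y)))
    ≤⟨ x-y≤x (0≤* 0≤1+M (0≤* (^ℚ-nonNeg 0≤y m) (0≤x*x (1ℚ - y)))) ⟩
  Y * (1ℚ + M * (1ℚ - y))
    ≤⟨ bernoulli 0≤y m ⟩
  1ℚ ∎
  where
  open ≤-Reasoning
  Y = y ^ℚ m
  M = fromℕ m
  0≤1+M : 0ℚ ≤ 1ℚ + M
  0≤1+M = subst (0ℚ ≤_) (fromℕ-homo-+ 1 m) (fromℕ-nonNeg (suc m))
  expand : ∀ y Y M → y * Y * (1ℚ + (1ℚ + M) * (1ℚ - y)) ≡ Y * (1ℚ + M * (1ℚ - y)) - (1ℚ + M) * (Y * ((1ℚ - y) * (1ℚ - y)))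
  expand = solve-∀ ℚ-ring

-- B = a − 1 active items remain after the deletion; u and v are 1/a and 1/B.
module BoundStep {B u v : ℚ} ([1+B]*u≡1 : (1ℚ + B) * u ≡ 1ℚ) (B*v≡1 : B * v ≡ 1ℚ)
                 (0≤u : 0ℚ ≤ u) (0≤v : 0ℚ ≤ v) (1≤B : 1ℚ ≤ B) where
  1-u≡B*u : 1ℚ - u ≡ B * u
  1-u≡B*u = begin
    1ℚ - u              ≡⟨ cong (_- u) [1+B]*u≡1 ⟨
    (1ℚ + B) * u - u    ≡⟨ solve (B ∷ u ∷ []) ℚ-ring ⟩
    B * u               ∎
    where open ≡-Reasoning

  0≤1-u : 0ℚ ≤ 1ℚ - u
  0≤1-u = subst (0ℚ ≤_) (sym 1-u≡B*u) (0≤* (≤-trans (nonNegative⁻¹ 1ℚ) 1≤B) 0≤u)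

  u*[1+v]≡v : u * (1ℚ + v) ≡ v
  u*[1+v]≡v = begin
    u * (1ℚ + v)              ≡⟨ solve (u ∷ v ∷ []) ℚ-ring ⟩
    1ℚ * u + v * u            ≡⟨ cong (λ w → w * u + v * u) B*v≡1 ⟨
    B * v * u + v * u         ≡⟨ solve (B ∷ u ∷ v ∷ []) ℚ-ring ⟩
    v * ((1ℚ + B) * u)        ≡⟨ cong (v *_) [1+B]*u≡1 ⟩
    v * 1ℚ                    ≡⟨ *-identityʳ v ⟩
    v                         ∎
    where open ≡-Reasoning

  1-v≡[1-v*v]*[1-u] : 1ℚ - v ≡ (1ℚ - v * v) * (1ℚ - u)
  1-v≡[1-v*v]*[1-u] = sym (begin
    (1ℚ - v * v) * (1ℚ - u)                 ≡⟨ solve (u ∷ v ∷ []) ℚ-ring ⟩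
    (1ℚ - v) * (1ℚ + v - u * (1ℚ + v))      ≡⟨ cong (λ w → (1ℚ - v) * (1ℚ + v - w)) u*[1+v]≡v ⟩
    (1ℚ - v) * (1ℚ + v - v)                 ≡⟨ solve (v ∷ []) ℚ-ring ⟩
    1ℚ - v                                  ∎)
    where open ≡-Reasoning

  0≤1-v*v : 0ℚ ≤ 1ℚ - v * v
  0≤1-v*v = subst (0ℚ ≤_) [1-v]*[1+v]≡1-v*v (0≤* 0≤1-v (+-mono-≤ (nonNegative⁻¹ 1ℚ) 0≤v))
    where
    open ≡-Reasoning
    [1-v]*[1+v]≡1-v*v : (1ℚ - v) * (1ℚ + v) ≡ 1ℚ - v * v
    [1-v]*[1+v]≡1-v*v = solve (v ∷ []) ℚ-ring
    0≤1-v : 0ℚ ≤ 1ℚ - v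
    0≤1-v = subst (0ℚ ≤_) (begin
      (B - 1ℚ) * v        ≡⟨ solve (B ∷ v ∷ []) ℚ-ring ⟩
      B * v - v           ≡⟨ cong (_- v) B*v≡1 ⟩
      1ℚ - v              ∎) (0≤* (+-monoˡ-≤ (- 1ℚ) 1≤B) 0≤v)

  B*B+M≡B*B*[1+M*v*v] : ∀ M → B * B + M ≡ B * B * (1ℚ + M * (1ℚ - (1ℚ - v * v)))
  B*B+M≡B*B*[1+M*v*v] M = sym (begin
    B * B * (1ℚ + M * (1ℚ - (1ℚ - v * v)))   ≡⟨ solve (B ∷ v ∷ M ∷ []) ℚ-ring ⟩
    B * B + M * ((B * v) * (B * v))          ≡⟨ cong (λ w → B * B + M * (w * w)) B*v≡1 ⟩
    B * B + M * (1ℚ * 1ℚ)                    ≡⟨ solve (B ∷ M ∷ []) ℚ-ring ⟩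
    B * B + M                                ∎)
    where open ≡-Reasoning

  [1+B]*[1-u]^2≡B*B*u : ∀ Q → (1ℚ + B) * ((1ℚ - u) * ((1ℚ - u) * Q)) ≡ B * B * u * Q
  [1+B]*[1-u]^2≡B*B*u Q = begin
    (1ℚ + B) * ((1ℚ - u) * ((1ℚ - u) * Q))   ≡⟨ cong (λ w → (1ℚ + B) * (w * (w * Q))) 1-u≡B*u ⟩
    (1ℚ + B) * (B * u * (B * u * Q))         ≡⟨ solve (B ∷ u ∷ Q ∷ []) ℚ-ring ⟩
    B * B * u * Q * ((1ℚ + B) * u)           ≡⟨ cong (B * B * u * Q *_) [1+B]*u≡1 ⟩
    B * B * u * Q * 1ℚ                       ≡⟨ *-identityʳ (B * B * u * Q) ⟩
    B * B * u * Q                            ∎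
    where open ≡-Reasoning

  recursion-rhs : ∀ M R →
    1ℚ + ((B - M) * u * (B * (1ℚ - (1ℚ - v) * R)) + (1ℚ + M) * u * (B * (1ℚ - R)))
      ≡ (1ℚ + B) - u * R * (B * B + M)
  recursion-rhs M R = begin
    1ℚ + ((B - M) * u * (B * (1ℚ - (1ℚ - v) * R)) + (1ℚ + M) * u * (B * (1ℚ - R)))
      ≡⟨ solve (B ∷ u ∷ v ∷ M ∷ R ∷ []) ℚ-ring ⟩
    1ℚ + B * ((1ℚ + B) * u) - u * R * ((B - M) * (B - B * v) + B * (1ℚ + M))
      ≡⟨ cong₂ (λ x y → 1ℚ + B * x - u * R * ((B - M) * (B - y) + B * (1ℚ + M))) [1+B]*u≡1 B*v≡1 ⟩
    1ℚ + B * 1ℚ - u * R * ((B - M) * (B - 1ℚ) + B * (1ℚ + M))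
      ≡⟨ solve (B ∷ u ∷ M ∷ R ∷ []) ℚ-ring ⟩
    (1ℚ + B) - u * R * (B * B + M) ∎
    where open ≡-Reasoning

  deficit-bound : ∀ m → u * (1ℚ - v) ^ℚ m * (B * B + fromℕ m) ≤ (1ℚ + B) * (1ℚ - u) ^ℚ suc (suc m)
  deficit-bound m = begin
    u * (1ℚ - v) ^ℚ m * (B * B + M)
      ≡⟨ cong₂ (λ r c → u * r * c) r^m≡Y*Q (B*B+M≡B*B*[1+M*v*v] M) ⟩
    u * (Y * Q) * (B * B * (1ℚ + M * (1ℚ - y)))
      ≡⟨ rearrange u Y Q (B * B) (1ℚ + M * (1ℚ - y)) ⟩
    B * B * u * Q * (Y * (1ℚ + M * (1ℚ - y)))
      ≤⟨ *-monoˡ-≤-nonNeg (B * B * u * Q) {{nonNegative 0≤B*B*u*Q}} (bernoulli 0≤1-v*v m) ⟩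
    B * B * u * Q * 1ℚ
      ≡⟨ *-identityʳ (B * B * u * Q) ⟩
    B * B * u * Q
      ≡⟨ [1+B]*[1-u]^2≡B*B*u Q ⟨
    (1ℚ + B) * (1ℚ - u) ^ℚ suc (suc m) ∎
    where
    open ≤-Reasoning
    M = fromℕ m
    y = 1ℚ - v * v
    Y = y ^ℚ m
    Q = (1ℚ - u) ^ℚ m
    r^m≡Y*Q : (1ℚ - v) ^ℚ m ≡ Y * Q
    r^m≡Y*Q = trans (cong (_^ℚ m) 1-v≡[1-v*v]*[1-u]) (^ℚ-distribʳ-* y (1ℚ - u) m)
    rearrange : ∀ a b c d e → a * (b * c) * (d * e) ≡ d * a * c * (b * e)
    rearrange = solve-∀ ℚ-ring
    0≤B*B*u*Q : 0ℚ ≤ B * B * u * Q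
    0≤B*B*u*Q = 0≤* (0≤* (0≤x*x B) 0≤u) (^ℚ-nonNeg 0≤1-u m)

  bound-step : ∀ m → let M = fromℕ m in
    (1ℚ + B) * (1ℚ - (1ℚ - u) ^ℚ suc (suc m))
      ≤ 1ℚ + ((B - M) * u * (B * (1ℚ - (1ℚ - v) ^ℚ suc m)) + (1ℚ + M) * u * (B * (1ℚ - (1ℚ - v) ^ℚ m)))
  bound-step m = begin
    (1ℚ + B) * (1ℚ - (1ℚ - u) ^ℚ suc (suc m))
      ≡⟨ *-distrib-1- (1ℚ + B) ((1ℚ - u) ^ℚ suc (suc m)) ⟩
    (1ℚ + B) - (1ℚ + B) * (1ℚ - u) ^ℚ suc (suc m)
      ≤⟨ +-monoʳ-≤ (1ℚ + B) (neg-antimono-≤ (deficit-bound m)) ⟩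
    (1ℚ + B) - u * (1ℚ - v) ^ℚ m * (B * B + fromℕ m)
      ≡⟨ recursion-rhs (fromℕ m) ((1ℚ - v) ^ℚ m) ⟨
    _ ∎
    where
    open ≤-Reasoning
    *-distrib-1- : ∀ a x → a * (1ℚ - x) ≡ a - a * x
    *-distrib-1- = solve-∀ ℚ-ring

bound : ℕ → ℕ → ℚ
bound a p = fromℕ (suc a) * (1ℚ - (1ℚ - + 1 / suc a) ^ℚ p)

bound-td-step : ∀ {b m} → m ℕ.≤ b →
  bound (suc b) (suc (suc m))
    ≤ 1ℚ + (+ (suc b ℕ.∸ m) / suc (suc b) * bound b (suc m) + + suc m / suc (suc b) * bound b m)
bound-td-step {b} {m} m≤b = begin
  bound (suc b) (suc (suc m))
    ≡⟨ cong (λ a → a * (1ℚ - (1ℚ - u) ^ℚ suc (suc m))) (fromℕ-homo-+ 1 (suc b)) ⟩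
  (1ℚ + B) * (1ℚ - (1ℚ - u) ^ℚ suc (suc m))
    ≤⟨ BoundStep.bound-step [1+B]*u≡1 B*v≡1 0≤u 0≤v 1≤B m ⟩
  1ℚ + ((B - M) * u * bound b (suc m) + (1ℚ + M) * u * bound b m)
    ≡⟨ cong₂ (λ c₁ c₂ → 1ℚ + (c₁ * bound b (suc m) + c₂ * bound b m)) c₁≡[B-M]*u c₂≡[1+M]*u ⟨
  _ ∎
  where
  open ≤-Reasoning
  B = fromℕ (suc b)
  M = fromℕ m
  u = + 1 / suc (suc b)
  v = + 1 / suc b
  [1+B]*u≡1 : (1ℚ + B) * u ≡ 1ℚ
  [1+B]*u≡1 = trans (cong (_* u) (sym (fromℕ-homo-+ 1 (suc b)))) (n*[1/n]≡1 (suc b))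
  B*v≡1 : B * v ≡ 1ℚ
  B*v≡1 = n*[1/n]≡1 b
  0≤u : 0ℚ ≤ u
  0≤u = nonNegative⁻¹ u {{normalize-nonNeg 1 (suc (suc b))}}
  0≤v : 0ℚ ≤ v
  0≤v = nonNegative⁻¹ v {{normalize-nonNeg 1 (suc b)}}
  1≤B : 1ℚ ≤ B
  1≤B = subst (1ℚ ≤_) (sym (fromℕ-homo-+ 1 b)) (+-monoʳ-≤ 1ℚ (fromℕ-nonNeg b))
  c₁≡[B-M]*u : + (suc b ℕ.∸ m) / suc (suc b) ≡ (B - M) * u
  c₁≡[B-M]*u = trans (+k/n≡k*[1/n] (suc b ℕ.∸ m) (suc b)) (cong (_* u) (fromℕ-homo-∸ (ℕ.m≤n⇒m≤1+n m≤b)))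
  c₂≡[1+M]*u : + suc m / suc (suc b) ≡ (1ℚ + M) * u
  c₂≡[1+M]*u = trans (+k/n≡k*[1/n] (suc m) (suc b)) (cong (_* u) (fromℕ-homo-+ 1 m))

E-no-pending : ∀ a k → E a 0 (td^ k) ≡ 0ℚ
E-no-pending a       zero    = refl
E-no-pending zero    (suc k) = refl
E-no-pending (suc a) (suc k) = E-no-pending a k

E-one-pending : ∀ a → E (suc a) 1 (td^ (suc a)) ≡ 1ℚ
E-one-pending a = trans (cong (λ e → 1ℚ + e) (E-no-pending a a)) (+-identityʳ 1ℚ)

bound-one-pending : ∀ a → bound a 1 ≡ 1ℚ
bound-one-pending a = trans (cong (fromℕ (suc a) *_) (1-[1-w]*1≡w (+ 1 / suc a))) (n*[1/n]≡1 a)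
  where
  1-[1-w]*1≡w : ∀ w → 1ℚ - (1ℚ - w) * 1ℚ ≡ w
  1-[1-w]*1≡w = solve-∀ ℚ-ring

lemma4 : (a p : ℕ) → p Data.Nat.≤ suc a →
    (+ suc a) / 1 * (1ℚ - (1ℚ - (+ 1) / suc a) ^ℚ p) Data.Rational.≤ E (suc a) p (td^ (suc a))
lemma4 a zero _ = ≤-reflexive (trans (*-zeroʳ (fromℕ (suc a))) (sym (E-no-pending (suc a) (suc a))))
lemma4 a 1 _ = ≤-reflexive (trans (bound-one-pending a) (sym (E-one-pending a)))
lemma4 zero (suc (suc m)) (s≤s ())
lemma4 (suc b) (suc (suc m)) (s≤s (s≤s m≤b)) = begin
  bound (suc b) (suc (suc m))
    ≤⟨ bound-td-step m≤b ⟩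
  1ℚ + (c₁ * bound b (suc m) + c₂ * bound b m)
    ≤⟨ +-monoʳ-≤ 1ℚ (+-mono-≤
         (*-monoˡ-≤-nonNeg c₁ {{normalize-nonNeg (suc b ℕ.∸ m) (suc (suc b))}} (lemma4 b (suc m) (s≤s m≤b)))
         (*-monoˡ-≤-nonNeg c₂ {{normalize-nonNeg (suc m) (suc (suc b))}} (lemma4 b m (ℕ.m≤n⇒m≤1+n m≤b)))) ⟩
  E (suc (suc b)) (suc (suc m)) (td^ (suc (suc b))) ∎
  where
  open ≤-Reasoning
  c₁ = + (suc b ℕ.∸ m) / suc (suc b)
  c₂ = + suc m / suc (suc b)
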